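{- Let $S=(s_1,s_2,\ldots)$ be a packing sequence with $s_1=1$, and let $n\ge 3$. (i) If $n\le s_2+2$, then $C_n$ is $\chi_S$-critical if and only if $n$ is odd. (ii) If $s_2+3\le n\le 2s_2+1$, then $C_n$ is $\chi_S$-critical.
   Context: All graphs are finite and simple; $C_n$ is the cycle on $n$ vertices. A packing sequence is an infinite non-decreasing sequence $S=(s_1,s_2,\ldots)$ of positive integers. A map $c:V(G)\to\{1,\ldots,m\}$ is an $S$-packing $m$-coloring if for distinct $u,v$, $c(u)=c(v)=i$ implies $d_G(u,v)>s_i$; $\chi_S(G)$ is the least such $m$. $G$ is $\chi_S$-critical if $\chi_S(H)<\chi_S(G)$ for every proper (nonempty) subgraph $H$ of $G$. -}

module Defs where

open import Level using (0ℓ)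
open import Data.Nat using (ℕ; zero; suc; _+_; _≤_; _<_; _∸_)
open import Data.Fin using (Fin; toℕ)
open import Data.Product using (Σ; _×_; _,_; ∃)
open import Data.Sum using (_⊎_; inj₁; inj₂)
open import Relation.Nullary using (¬_)
open import Relation.Binary.PropositionalEquality using (_≡_; _≢_; trans; sym)
open import Function.Definitions using (Injective)

-- A packing sequence S = (s_1, s_2, ...): positive, non-decreasing.
-- Convention: (seq k) is s_{k+1}, i.e. seq 0 = s_1, seq 1 = s_2, ...
record PackingSeq : Set where
  field
    seq      : ℕ → ℕ
    positive : ∀ k → 1 ≤ seq k
    mono     : ∀ k → seq k ≤ seq (suc k)
open PackingSeq public

record Graph : Set₁ where
  field
    size  : ℕ
    Adj   : Fin size → Fin size → Set
    Adj-sym : ∀ {u v} → Adj u v → Adj v u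
    irrefl : ∀ {u} → ¬ Adj u u
open Graph public

data Walk (G : Graph) : Fin (size G) → Fin (size G) → ℕ → Set where
  here : ∀ {u} → Walk G u u zero
  step : ∀ {u w v k} → Adj G u w → Walk G w v k → Walk G u v (suc k)

-- d_G(u,v) > d  (includes the case d_G(u,v) = ∞, i.e. no walk at all)
DistGt : (G : Graph) → Fin (size G) → Fin (size G) → ℕ → Set
DistGt G u v d = ∀ k → k ≤ d → ¬ Walk G u v k

-- S-packing m-coloring; colour (i : Fin m) stands for colour toℕ i + 1,
-- with parameter s_{toℕ i + 1} = seq S (toℕ i).
IsPackingColoring : PackingSeq → (G : Graph) → (m : ℕ) → (Fin (size G) → Fin m) → Set
IsPackingColoring S G m c =
  ∀ u v → u ≢ v → c u ≡ c v → DistGt G u v (seq S (toℕ (c u)))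

PackingColorable : PackingSeq → Graph → ℕ → Set
PackingColorable S G m = Σ (Fin (size G) → Fin m) (IsPackingColoring S G m)

IsChiS : PackingSeq → Graph → ℕ → Set
IsChiS S G k = PackingColorable S G k × (∀ m → PackingColorable S G m → k ≤ m)

record Subgraph (H G : Graph) : Set where
  field
    emb     : Fin (size H) → Fin (size G)
    inj     : Injective _≡_ _≡_ emb
    homEdge : ∀ {a b} → Adj H a b → Adj G (emb a) (emb b)
open Subgraph public

Proper : ∀ {H G} → Subgraph H G → Set
Proper {H} {G} f =
  (Σ (Fin (size G)) λ v → ∀ a → emb f a ≢ v)
  ⊎ (Σ (Fin (size G)) λ u → Σ (Fin (size G)) λ v → Adj G u v ×
       (∀ a b → Adj H a b → ¬ (emb f a ≡ u × emb f b ≡ v)))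

Nonempty : Graph → Set
Nonempty H = 1 ≤ size H

Critical : PackingSeq → Graph → Set₁
Critical S G =
  ∀ (H : Graph) (f : Subgraph H G) → Proper f → Nonempty H →
  ∀ k k' → IsChiS S G k → IsChiS S H k' → k' < k

-- The cycle C_n for n = k + 3 (so n ≥ 3), vertex set Fin n, vertex i adjacent to i+1 mod n.
CycStep : (k : ℕ) → Fin (3 + k) → Fin (3 + k) → Set
CycStep k i j = (suc (toℕ i) ≡ toℕ j) ⊎ ((toℕ i ≡ 2 + k) × (toℕ j ≡ 0))

CycAdj : (k : ℕ) → Fin (3 + k) → Fin (3 + k) → Set
CycAdj k i j = CycStep k i j ⊎ CycStep k j i

private
  n≢1+n : ∀ {x : ℕ} → suc x ≢ x
  n≢1+n ()

  stepIrr : ∀ k {i} → ¬ CycStep k i i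
  stepIrr k (inj₁ e) = n≢1+n e
  stepIrr k (inj₂ (e₁ , e₂)) with trans (sym e₁) e₂
  ... | ()

Cycle3+ : ℕ → Graph
Cycle3+ k = record
  { size = 3 + k
  ; Adj = CycAdj k
  ; Adj-sym = λ { (inj₁ p) → inj₂ p ; (inj₂ p) → inj₁ p }
  ; irrefl = λ { (inj₁ p) → stepIrr k p ; (inj₂ p) → stepIrr k p }
  }

C : (n : ℕ) → 3 ≤ n → Graph
C n 3≤n = Cycle3+ (n ∸ 3)

-- Suppose n ≤ 2s₂ + 1. Any two vertices of C_n are then within distance s₂, so only color 1 can
-- repeat, and since s₁ = 1 its class is independent. Picking from each of ⌊n/2⌋ disjoint edges an
-- endpoint not colored 1, plus for odd n one more such vertex (the last one, or vertex 0 if the last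
-- is colored 1), gives χ_S(C_n) ≥ ⌊n/2⌋ + 1 for even n and ≥ ⌈n/2⌉ + 1 for odd n.
-- A proper subgraph misses some edge of C_n; cutting the cycle there maps it injectively into the
-- path 0, 1, …, n − 1 with adjacent vertices at most one position apart, so distances do not shrink.
-- That path is colored by giving even positions color 1 and position 2a + 1 color a + 2, which uses
-- ⌊n/2⌋ + 1 colors; for even n ≥ s₂ + 3 the last position may reuse color 2, being at distance
-- n − 2 > s₂ from position 1. Either way one color fewer than C_n needs, so C_n is critical.
-- For even n ≤ s₂ + 2, deleting the edge between the two ends leaves a path that still needs
-- n/2 + 1 colors, since its vertices other than one of the ends are pairwise within distance s₂.

module Submission where

open import Defs
open import Data.Nat using (ℕ; _+_; _*_; _≤_; _%_)
open import Data.Product using (_×_)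
open import Relation.Binary.PropositionalEquality using (_≡_)
open import Data.Nat using (zero; suc; _<_; _∸_; z≤n; s≤s; s≤s⁻¹; ∣_-_∣; _≟_; _≤?_; _<?_)
open import Data.Nat.Properties
open import Data.Nat.DivMod using ([m+kn]%n≡m%n; m*n%n≡0)
open import Data.Fin using (Fin; toℕ; fromℕ; fromℕ<) renaming (zero to fzero; suc to fsuc)
open import Data.Fin.Properties using (toℕ-injective; toℕ<n; toℕ≤pred[n]; toℕ-fromℕ; toℕ-fromℕ<; injective⇒≤)
  renaming (_≟_ to _≟ᶠ_)
open import Data.Vec.Functional using (_∷_)
open import Data.Product using (Σ; ∃; ∃₂; _,_; proj₁; proj₂)
open import Data.Sum using (_⊎_; inj₁; inj₂)
open import Data.Empty using (⊥; ⊥-elim)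
open import Data.Nat.Tactic.RingSolver using (solve-∀)
open import Relation.Binary.Definitions using (tri<; tri≈; tri>)
open import Function.Base using (_∘_)
open import Function.Definitions using (Injective)
open import Relation.Nullary using (¬_; yes; no)
open import Relation.Binary.PropositionalEquality using (_≢_; refl; sym; trans; cong; subst; subst₂; module ≡-Reasoning)

-- Parity and the alternating coloring

Even Odd : ℕ → Set
Even n = ∃ λ a → n ≡ 2 * a
Odd n = ∃ λ a → n ≡ suc (2 * a)

even-or-odd : ∀ n → Even n ⊎ Odd n
even-or-odd zero = inj₁ (0 , refl)
even-or-odd (suc n) with even-or-odd n
... | inj₁ (a , refl) = inj₂ (a , refl)
... | inj₂ (a , refl) = inj₁ (suc a , cong suc (sym (+-suc a (a + 0))))

even-not-odd : ∀ {n} → Even n → Odd n → ⊥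
even-not-odd (a , refl) (b , e) = even≢odd a b e

distinct-evens-far : ∀ {a b} → a ≢ b → 2 ≤ ∣ 2 * a - 2 * b ∣
distinct-evens-far {a} {b} a≢b =
  subst (2 ≤_) (*-distribˡ-∣-∣ 2 a b)
    (*-monoʳ-≤ 2 (n≢0⇒n>0 (a≢b ∘ ∣m-n∣≡0⇒m≡n)))

even-%2 : ∀ {n} → Even n → n % 2 ≡ 0
even-%2 (a , refl) = subst (λ m → m % 2 ≡ 0) (*-comm a 2) (m*n%n≡0 a 2)

odd-%2 : ∀ {n} → Odd n → n % 2 ≡ 1
odd-%2 (a , refl) = subst (λ m → suc m % 2 ≡ 1) (*-comm a 2) ([m+kn]%n≡m%n 1 a 2)

alternating : ℕ → ℕ
alternating n with even-or-odd n
... | inj₁ _       = 0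
... | inj₂ (a , _) = suc a

alternating-even : ∀ {p} → Even p → alternating p ≡ 0
alternating-even {p} ev with even-or-odd p
... | inj₁ _  = refl
... | inj₂ od = ⊥-elim (even-not-odd ev od)

alternating-collision : ∀ {p q} → p ≢ q → alternating p ≡ alternating q → Even p × Even q
alternating-collision {p} {q} p≢q same with even-or-odd p | even-or-odd q
... | inj₁ ev-p       | inj₁ ev-q       = ev-p , ev-q
... | inj₁ _          | inj₂ _          = ⊥-elim (0≢1+n same)
... | inj₂ _          | inj₁ _          = ⊥-elim (0≢1+n (sym same))
... | inj₂ (a , refl) | inj₂ (b , refl) = ⊥-elim (p≢q (cong (suc ∘ (2 *_)) (suc-injective same)))

alternating≡1 : ∀ {p} → alternating p ≡ 1 → p ≡ 1
alternating≡1 {p} is-1 with even-or-odd p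
... | inj₁ _             = ⊥-elim (0≢1+n is-1)
... | inj₂ (zero , refl) = refl
... | inj₂ (suc a , _)   = ⊥-elim (0≢1+n (sym (suc-injective is-1)))

alternating-≤ : ∀ {p b} → p ≤ 2 * b → alternating p ≤ b
alternating-≤ {p} {b} p≤2b with even-or-odd p
... | inj₁ _          = z≤n
... | inj₂ (a , refl) = *-cancelˡ-< 2 a b p≤2b

window-distance : ∀ {lo w x y} → lo ≤ x → x ≤ lo + w → lo ≤ y → y ≤ lo + w → ∣ x - y ∣ ≤ w
window-distance {lo} {w} lo≤x x≤ lo≤y y≤ with m≤n⇒∃[o]m+o≡n lo≤x | m≤n⇒∃[o]m+o≡n lo≤y
... | x′ , refl | y′ , refl =
  subst (_≤ w) (sym (∣m+n-m+o∣≡∣n-o∣ lo x′ y′))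
    (≤-trans (∣m-n∣≤m⊔n x′ y′) (⊔-lub (+-cancelˡ-≤ lo x′ w x≤) (+-cancelˡ-≤ lo y′ w y≤)))

lo+2[1+i] : ∀ lo i → lo + 2 * suc i ≡ suc (suc (lo + 2 * i))
lo+2[1+i] = solve-∀

pair-start-< : ∀ lo {i j} → i < j → suc (lo + 2 * i) < lo + 2 * j
pair-start-< lo {i} {j} i<j = subst (_≤ lo + 2 * j) (lo+2[1+i] lo i) (+-monoʳ-≤ lo (*-monoʳ-≤ 2 i<j))

InPair : ℕ → ℕ → ℕ → Set
InPair lo i p = lo + 2 * i ≤ p × p ≤ suc (lo + 2 * i)

pair-index-unique : ∀ {lo p i j} → InPair lo i p → InPair lo j p → i ≡ j
pair-index-unique {lo} {i = i} {j} (i≤p , p≤i) (j≤p , p≤j) with <-cmp i j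
... | tri≈ _ i≡j _ = i≡j
... | tri< i<j _ _ = ⊥-elim (<-irrefl refl (≤-trans (s≤s p≤i) (≤-trans (pair-start-< lo i<j) j≤p)))
... | tri> _ _ j<i = ⊥-elim (<-irrefl refl (≤-trans (s≤s p≤j) (≤-trans (pair-start-< lo j<i) i≤p)))

m>n⇒m∸n≡suc[m∸suc[n]] : ∀ {m n} → n < m → m ∸ n ≡ suc (m ∸ suc n)
m>n⇒m∸n≡suc[m∸suc[n]] = +-∸-assoc 1

-- u + 1 + e is the detour round a cycle of length 1 + u + d + e ≤ 1 + 2s avoiding a route of length d > s.
around-≤ : ∀ u d e s → suc (u + d + e) ≤ suc (2 * s) → s < d → u + suc e ≤ s
around-≤ u d e s total s<d = +-cancelʳ-≤ s (u + suc e) s (begin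
  u + suc e + s  ≡⟨ shift u e s ⟩
  u + e + suc s  ≤⟨ +-monoʳ-≤ (u + e) s<d ⟩
  u + e + d      ≡⟨ swap u e d ⟩
  u + d + e      ≤⟨ s≤s⁻¹ total ⟩
  2 * s          ≡⟨ cong (s +_) (+-identityʳ s) ⟩
  s + s          ∎)
  where
    open ≤-Reasoning
    shift : ∀ u e s → u + suc e + s ≡ u + e + suc s
    shift = solve-∀
    swap : ∀ u e d → u + e + d ≡ u + d + e
    swap = solve-∀

∣n-1+n∣≡1 : ∀ n → ∣ n - suc n ∣ ≡ 1
∣n-1+n∣≡1 zero = refl
∣n-1+n∣≡1 (suc n) = ∣n-1+n∣≡1 n

n≤m+1⇒n≤1+m : ∀ {n m} → n ≤ m + 1 → n ≤ suc m
n≤m+1⇒n≤1+m {n} {m} = subst (n ≤_) (+-comm m 1)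

s+2≤2s+1 : ∀ {s} → 1 ≤ s → s + 2 ≤ 2 * s + 1
s+2≤2s+1 {s} 1≤s = subst₂ _≤_ (+-assoc s 1 1) (cong (_+ 1) (cong (s +_) (sym (+-identityʳ s))))
  (+-monoˡ-≤ 1 (+-monoʳ-≤ s 1≤s))

-- Walks and packing colorings

module _ {G : Graph} where
  infixr 5 _++ʷ_

  _++ʷ_ : ∀ {u v w i j} → Walk G u v i → Walk G v w j → Walk G u w (i + j)
  here     ++ʷ q = q
  step a p ++ʷ q = step a (p ++ʷ q)

  reverseʷ : ∀ {u v ℓ} → Walk G u v ℓ → Walk G v u ℓ
  reverseʷ here               = here
  reverseʷ (step {k = ℓ} a p) = subst (Walk G _ _) (+-comm ℓ 1) (reverseʷ p ++ʷ step (Adj-sym G a) here)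

  walk-zero : ∀ {u v} → Walk G u v 0 → u ≡ v
  walk-zero here = refl

  walk-one : ∀ {u v} → Walk G u v 1 → Adj G u v
  walk-one (step a here) = a

  walk-lipschitz : (r : Fin (size G) → ℕ) → (∀ {u v} → Adj G u v → ∣ r u - r v ∣ ≤ 1) →
                   ∀ {u v ℓ} → Walk G u v ℓ → ∣ r u - r v ∣ ≤ ℓ
  walk-lipschitz r r-adj {u} here = ≤-reflexive (∣n-n∣≡0 (r u))
  walk-lipschitz r r-adj {u} {v} (step {w = w} a p) =
    ≤-trans (∣-∣-triangle (r u) (r w) (r v)) (+-mono-≤ (r-adj a) (walk-lipschitz r r-adj p))

mapʷ : ∀ {H G} (f : Subgraph H G) {a b ℓ} → Walk H a b ℓ → Walk G (emb f a) (emb f b) ℓ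
mapʷ f here       = here
mapʷ f (step a p) = step (homEdge f a) (mapʷ f p)

Close : PackingSeq → (G : Graph) → Fin (size G) → Fin (size G) → Set
Close S G u v = ∃ λ ℓ → ℓ ≤ seq S 1 × Walk G u v ℓ

seq-1≤seq : ∀ S {n} (i : Fin (suc n)) → i ≢ fzero → seq S 1 ≤ seq S (toℕ i)
seq-1≤seq S fzero    i≢0 = ⊥-elim (i≢0 refl)
seq-1≤seq S (fsuc i) _   = go (toℕ i)
  where
    go : ∀ n → seq S 1 ≤ seq S (suc n)
    go zero    = ≤-refl
    go (suc n) = ≤-trans (go n) (mono S (suc n))

-- IsPackingColoring with colors as natural numbers; 0 is the paper's color 1.
IsPackingColoringℕ : PackingSeq → (G : Graph) → (Fin (size G) → ℕ) → Set
IsPackingColoringℕ S G c = ∀ u v → u ≢ v → c u ≡ c v → DistGt G u v (seq S (c u))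

colorable-of-bounded : ∀ S G {m} (c : Fin (size G) → ℕ) → (∀ v → c v < m) →
                       IsPackingColoringℕ S G c → PackingColorable S G m
colorable-of-bounded S G c c<m c-ok = (λ v → fromℕ< (c<m v)) , ok
  where
    ok : IsPackingColoring S G _ (λ v → fromℕ< (c<m v))
    ok u v u≢v same =
      subst (DistGt G u v ∘ seq S) (sym (toℕ-fromℕ< (c<m u)))
        (c-ok u v u≢v (trans (sym (toℕ-fromℕ< (c<m u))) (trans (cong toℕ same) (toℕ-fromℕ< (c<m v)))))

pullback : ∀ {S H G} (f : Subgraph H G) {c : Fin (size G) → ℕ} →
           IsPackingColoringℕ S G c → IsPackingColoringℕ S H (c ∘ emb f)
pullback f c-ok a b a≢b same ℓ ℓ≤ w = c-ok _ _ (a≢b ∘ inj f) same ℓ ℓ≤ (mapʷ f w)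

lower-bound-of-nonempty : ∀ {S G L} → Fin (size G) →
  (∀ {m} (c : Fin (size G) → Fin (suc m)) → IsPackingColoring S G (suc m) c → L ≤ suc m) →
  ∀ m → PackingColorable S G m → L ≤ m
lower-bound-of-nonempty v bound zero (c , _) with c v
... | ()
lower-bound-of-nonempty v bound (suc m) (c , c-ok) = bound c c-ok

critical-of-bounds : ∀ S G K → (∀ m → PackingColorable S G m → suc K ≤ m) →
                     (∀ H (f : Subgraph H G) → Proper f → PackingColorable S H K) → Critical S G
critical-of-bounds S G K G-bound H-colorable H f proper _ k k′ (G-col , _) (_ , H-least) =
  ≤-<-trans (H-least K (H-colorable H f proper)) (G-bound k G-col)

alternating-coloring : ∀ S G → seq S 0 ≡ 1 →
  (∀ {u v} → Adj G u v → Even (toℕ u) → Even (toℕ v) → ⊥) → IsPackingColoringℕ S G (alternating ∘ toℕ)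
alternating-coloring S G s₁≡1 bipartite u v u≢v same ℓ ℓ≤ w
  with alternating-collision (u≢v ∘ toℕ-injective) same
... | ev-u , ev-v = no-short-walk ℓ (subst (ℓ ≤_) (trans (cong (seq S) (alternating-even ev-u)) s₁≡1) ℓ≤) w
  where
    no-short-walk : ∀ ℓ → ℓ ≤ 1 → ¬ Walk G u v ℓ
    no-short-walk zero          _        w = u≢v (walk-zero w)
    no-short-walk (suc zero)    _        w = bipartite (walk-one w) ev-u ev-v
    no-short-walk (suc (suc _)) (s≤s ()) _

-- Lower bounds from vertices pairwise within distance s₂

∷-injective : ∀ {A : Set} {n} {x : A} {xs : Fin n → A} →
              Injective _≡_ _≡_ xs → (∀ j → xs j ≢ x) → Injective _≡_ _≡_ (x ∷ xs)
∷-injective xs-inj fresh {fzero}  {fzero}  _ = refl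
∷-injective xs-inj fresh {fzero}  {fsuc j} e = ⊥-elim (fresh j (sym e))
∷-injective xs-inj fresh {fsuc i} {fzero}  e = ⊥-elim (fresh i e)
∷-injective xs-inj fresh {fsuc i} {fsuc j} e = cong fsuc (xs-inj e)

module FirstColor (S : PackingSeq) (s₁≡1 : seq S 0 ≡ 1) (G : Graph) {m : ℕ}
                   (c : Fin (size G) → Fin (suc m)) (c-ok : IsPackingColoring S G (suc m) c) where

  first-color-independent : ∀ {u v} → Adj G u v → c u ≡ fzero → c v ≢ fzero
  first-color-independent {u} {v} a cu≡0 cv≡0 =
    c-ok u v u≢v (trans cu≡0 (sym cv≡0)) 1
      (subst (λ i → 1 ≤ seq S (toℕ i)) (sym cu≡0) (≤-reflexive (sym s₁≡1))) (step a here)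
    where
      u≢v : u ≢ v
      u≢v refl = irrefl G a

  -- Vertices within distance s₂ of each other and off the first color need pairwise distinct colors.
  close-vertices-bound : ∀ {L} (X : Fin L → Fin (size G)) → Injective _≡_ _≡_ X →
                         (∀ j → c (X j) ≢ fzero) → (∀ i j → Close S G (X i) (X j)) → suc L ≤ suc m
  close-vertices-bound X X-inj nonfirst close = injective⇒≤ (∷-injective colors-injective nonfirst)
    where
      colors-injective : Injective _≡_ _≡_ (c ∘ X)
      colors-injective {i} {j} same with X i ≟ᶠ X j | close i j
      ... | yes Xi≡Xj | _              = X-inj Xi≡Xj
      ... | no Xi≢Xj  | ℓ , ℓ≤s₂ , walk =
        ⊥-elim (c-ok (X i) (X j) Xi≢Xj same ℓ (≤-trans ℓ≤s₂ (seq-1≤seq S (c (X i)) (nonfirst i))) walk)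

module Linear (G : Graph) (next : ∀ {u v : Fin (size G)} → suc (toℕ u) ≡ toℕ v → Adj G u v) where

  forward-walk : ∀ ℓ {u v} → toℕ u + ℓ ≡ toℕ v → Walk G u v ℓ
  forward-walk zero {u} u+0≡v = subst (λ v → Walk G u v 0) (toℕ-injective (trans (sym (+-identityʳ _)) u+0≡v)) here
  forward-walk (suc ℓ) {u} {v} u+1+ℓ≡v =
    step (next (sym (toℕ-fromℕ< u+1<N))) (forward-walk ℓ (trans (cong (_+ ℓ) (toℕ-fromℕ< u+1<N)) 1+u+ℓ≡v))
    where
      1+u+ℓ≡v : suc (toℕ u) + ℓ ≡ toℕ v
      1+u+ℓ≡v = trans (sym (+-suc (toℕ u) ℓ)) u+1+ℓ≡v
      u+1<N : suc (toℕ u) < size G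
      u+1<N = ≤-trans (s≤s (subst (suc (toℕ u) ≤_) 1+u+ℓ≡v (m≤m+n _ ℓ))) (toℕ<n v)

  straight-walk : ∀ u v → Walk G u v ∣ toℕ u - toℕ v ∣
  straight-walk u v with ≤-total (toℕ u) (toℕ v)
  ... | inj₁ u≤v = subst (Walk G u v) (sym (m≤n⇒∣m-n∣≡n∸m u≤v)) (forward-walk _ (m+[n∸m]≡n u≤v))
  ... | inj₂ v≤u = subst (Walk G u v) (sym (m≤n⇒∣n-m∣≡n∸m v≤u)) (reverseʷ (forward-walk _ (m+[n∸m]≡n v≤u)))

  window-close : ∀ S lo {u v} → lo ≤ toℕ u → toℕ u ≤ lo + seq S 1 → lo ≤ toℕ v → toℕ v ≤ lo + seq S 1 →
                 Close S G u v
  window-close S lo {u} {v} lo≤u u≤ lo≤v v≤ = _ , window-distance lo≤u u≤ lo≤v v≤ , straight-walk u v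

  module PairChoice (S : PackingSeq) (s₁≡1 : seq S 0 ≡ 1) {m : ℕ}
                    (c : Fin (size G) → Fin (suc m)) (c-ok : IsPackingColoring S G (suc m) c) where
    open FirstColor S s₁≡1 G c c-ok

    nonfirst-in-pair : ∀ t → suc t < size G →
                       Σ (Fin (size G)) λ x → (t ≤ toℕ x × toℕ x ≤ suc t) × c x ≢ fzero
    nonfirst-in-pair t t+1<N with c (fromℕ< (<⇒≤ t+1<N)) ≟ᶠ fzero
    ... | yes c-t≡0 = fromℕ< t+1<N , (pos-t+1 , ≤-reflexive (toℕ-fromℕ< t+1<N)) ,
                      first-color-independent (next (trans (cong suc (toℕ-fromℕ< _)) (sym (toℕ-fromℕ< t+1<N)))) c-t≡0
      where
        pos-t+1 : t ≤ toℕ (fromℕ< t+1<N)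
        pos-t+1 = subst (t ≤_) (sym (toℕ-fromℕ< t+1<N)) (n≤1+n t)
    ... | no c-t≢0 = _ , (≤-reflexive (sym (toℕ-fromℕ< _)) , m≤n⇒m≤1+n (≤-reflexive (toℕ-fromℕ< _))) , c-t≢0

    module Pairs (lo L : ℕ) (fits : lo + 2 * L ≤ size G) where

      private
        choice : (j : Fin L) → Σ (Fin (size G)) λ x → InPair lo (toℕ j) (toℕ x) × c x ≢ fzero
        choice j = nonfirst-in-pair (lo + 2 * toℕ j) (≤-trans (pair-start-< lo (toℕ<n j)) fits)

      pairs : Fin L → Fin (size G)
      pairs = proj₁ ∘ choice

      pairs-position : ∀ j → InPair lo (toℕ j) (toℕ (pairs j))
      pairs-position = proj₁ ∘ proj₂ ∘ choice

      pairs-nonfirst : ∀ j → c (pairs j) ≢ fzero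
      pairs-nonfirst = proj₂ ∘ proj₂ ∘ choice

      pairs-injective : Injective _≡_ _≡_ pairs
      pairs-injective {i} {j} same =
        toℕ-injective (pair-index-unique {lo} (subst (InPair lo (toℕ i) ∘ toℕ) same (pairs-position i)) (pairs-position j))

      pairs-above : ∀ j → lo ≤ toℕ (pairs j)
      pairs-above j = ≤-trans (m≤m+n lo _) (proj₁ (pairs-position j))

      pairs-below : ∀ j → toℕ (pairs j) < lo + 2 * L
      pairs-below j = ≤-<-trans (proj₂ (pairs-position j)) (pair-start-< lo (toℕ<n j))

      pairs-bound : (∀ i j → Close S G (pairs i) (pairs j)) → suc L ≤ suc m
      pairs-bound = close-vertices-bound pairs pairs-injective pairs-nonfirst

      apex-pairs-bound : ∀ w → c w ≢ fzero → ¬ (lo ≤ toℕ w × toℕ w < lo + 2 * L) →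
                         (∀ i j → Close S G ((w ∷ pairs) i) ((w ∷ pairs) j)) → suc (suc L) ≤ suc m
      apex-pairs-bound w cw≢0 outside = close-vertices-bound (w ∷ pairs) (∷-injective pairs-injective fresh) nonfirst
        where
          fresh : ∀ j → pairs j ≢ w
          fresh j refl = outside (pairs-above j , pairs-below j)
          nonfirst : ∀ j → c ((w ∷ pairs) j) ≢ fzero
          nonfirst fzero    = cw≢0
          nonfirst (fsuc j) = pairs-nonfirst j

-- Cycles and their proper subgraphs

IsPathColoring : PackingSeq → ℕ → (ℕ → ℕ) → Set
IsPathColoring S N Q = ∀ {p q} → p < N → q < N → p ≢ q → Q p ≡ Q q → seq S (Q p) < ∣ p - q ∣

alternating-path-coloring : ∀ S {N} → seq S 0 ≡ 1 → IsPathColoring S N alternating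
alternating-path-coloring S s₁≡1 _ _ p≢q same with alternating-collision p≢q same
... | (a , refl) , (b , refl) =
  subst (_< _) (sym (trans (cong (seq S) (alternating-even (a , refl))) s₁≡1))
    (distinct-evens-far {a} {b} (p≢q ∘ cong (2 *_)))

alternating-< : ∀ {p b} → p < suc (2 * b) → alternating p < suc b
alternating-< p< = s≤s (alternating-≤ (s≤s⁻¹ p<))

recolor-last : ℕ → ℕ → ℕ
recolor-last N p with suc p ≟ N
... | yes _ = 1
... | no _  = alternating p

last-far-from-1 : ∀ S {N r} → 3 + seq S 1 ≤ N → suc r ≡ N → seq S 1 < ∣ r - 1 ∣
last-far-from-1 S {r = zero}  long refl = ⊥-elim (<-irrefl refl (≤-trans (s≤s (s≤s z≤n)) long))
last-far-from-1 S {r = suc r} long refl = subst (seq S 1 <_) (sym (∣-∣-identityʳ r)) (s≤s⁻¹ (s≤s⁻¹ long))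

recolor-last-coloring : ∀ S {N} → seq S 0 ≡ 1 → 3 + seq S 1 ≤ N → IsPathColoring S N (recolor-last N)
recolor-last-coloring S {N} s₁≡1 long {p} {q} p<N q<N p≢q same with suc p ≟ N | suc q ≟ N
... | yes p-last | yes q-last = ⊥-elim (p≢q (suc-injective (trans p-last (sym q-last))))
... | no _       | no _       = alternating-path-coloring S s₁≡1 p<N q<N p≢q same
... | yes p-last | no _       =
  subst (λ r → seq S 1 < ∣ p - r ∣) (sym (alternating≡1 (sym same))) (last-far-from-1 S long p-last)
... | no _       | yes q-last =
  subst (λ r → seq S (alternating r) < ∣ r - q ∣) (sym (alternating≡1 same))
    (subst (seq S 1 <_) (∣-∣-comm q 1) (last-far-from-1 S long q-last))

recolor-last-< : ∀ {p b} → 2 ≤ b → p < 2 * b → recolor-last (2 * b) p < b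
recolor-last-< {b = zero} () _
recolor-last-< {p} {suc b′} 2≤b p<2b with suc p ≟ 2 * suc b′
... | yes _       = 2≤b
... | no p+1≢2b =
  s≤s (alternating-≤ (s≤s⁻¹ (s≤s⁻¹ (subst (suc (suc p) ≤_) (lo+2[1+i] 0 b′) (≤∧≢⇒< p<2b p+1≢2b)))))

module Cycle (k : ℕ) where

  last : Fin (3 + k)
  last = fromℕ (2 + k)

  wrap : Adj (Cycle3+ k) fzero last
  wrap = inj₂ (inj₂ (toℕ-fromℕ (2 + k) , refl))

  next : ∀ {u v : Fin (3 + k)} → suc (toℕ u) ≡ toℕ v → Adj (Cycle3+ k) u v
  next = inj₁ ∘ inj₁

  open Linear (Cycle3+ k) next

  no-position-beyond-last : ∀ {v : Fin (3 + k)} → toℕ v ≢ 3 + k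
  no-position-beyond-last {v} v≡N = <-irrefl v≡N (toℕ<n v)

  step-functional : ∀ {w w₁ w₂} → CycStep k w w₁ → CycStep k w w₂ → w₁ ≡ w₂
  step-functional (inj₁ w+1≡w₁) (inj₁ w+1≡w₂) = toℕ-injective (trans (sym w+1≡w₁) w+1≡w₂)
  step-functional (inj₁ w+1≡w₁) (inj₂ (w≡last , _)) =
    ⊥-elim (no-position-beyond-last (trans (sym w+1≡w₁) (cong suc w≡last)))
  step-functional (inj₂ (w≡last , _)) (inj₁ w+1≡w₂) =
    ⊥-elim (no-position-beyond-last (trans (sym w+1≡w₂) (cong suc w≡last)))
  step-functional (inj₂ (_ , w₁≡0)) (inj₂ (_ , w₂≡0)) = toℕ-injective (trans w₁≡0 (sym w₂≡0))

  cycle-successor : ∀ v → ∃ λ w → CycStep k v w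
  cycle-successor v with toℕ v <? 2 + k
  ... | yes v<last = fromℕ< (s≤s v<last) , inj₁ (sym (toℕ-fromℕ< (s≤s v<last)))
  ... | no v≮last  = fzero , inj₂ (≤-antisym (toℕ≤pred[n] v) (≮⇒≥ v≮last) , refl)

  module _ (S : PackingSeq) (small : 3 + k ≤ suc (2 * seq S 1)) where

    close-forward : ∀ {u v} → toℕ u ≤ toℕ v → Close S (Cycle3+ k) u v
    close-forward {u} {v} u≤v with m≤n⇒∃[o]m+o≡n u≤v | m≤n⇒∃[o]m+o≡n (toℕ≤pred[n] v)
    ... | d , u+d≡v | e , v+e≡2+k with d ≤? seq S 1
    ... | yes d≤s₂ = d , d≤s₂ , forward-walk d u+d≡v
    ... | no d≰s₂  =
      toℕ u + suc e , around-≤ (toℕ u) d e (seq S 1) total (≰⇒> d≰s₂) ,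
      reverseʷ (forward-walk (toℕ u) refl) ++ʷ step wrap (reverseʷ (forward-walk e (trans v+e≡2+k (sym (toℕ-fromℕ _)))))
      where
        total : suc (toℕ u + d + e) ≤ suc (2 * seq S 1)
        total = subst (λ n → suc n ≤ suc (2 * seq S 1)) (sym (trans (cong (_+ e) u+d≡v) v+e≡2+k)) small

    cycle-close : ∀ u v → Close S (Cycle3+ k) u v
    cycle-close u v with ≤-total (toℕ u) (toℕ v)
    ... | inj₁ u≤v = close-forward u≤v
    ... | inj₂ v≤u with close-forward v≤u
    ...   | ℓ , ℓ≤s₂ , walk = ℓ , ℓ≤s₂ , reverseʷ walk

  module LowerBounds (S : PackingSeq) (s₁≡1 : seq S 0 ≡ 1) (small : 3 + k ≤ suc (2 * seq S 1))
                     {m : ℕ} (c : Fin (3 + k) → Fin (suc m)) (c-ok : IsPackingColoring S (Cycle3+ k) (suc m) c) where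
    open FirstColor S s₁≡1 (Cycle3+ k) c c-ok
    open PairChoice S s₁≡1 c c-ok

    even-cycle-bound : ∀ {b} → 3 + k ≡ 2 * b → suc b ≤ suc m
    even-cycle-bound {b} N≡2b = pairs-bound (λ _ _ → cycle-close S small _ _)
      where open Pairs 0 b (≤-reflexive (sym N≡2b))

    -- Either the last vertex, or (when it has the first color) vertex 0, tops up the pairs to b + 1 vertices.
    odd-cycle-bound : ∀ {b} → 3 + k ≡ suc (2 * b) → suc (suc b) ≤ suc m
    odd-cycle-bound {b} N≡1+2b with c last ≟ᶠ fzero
    ... | no c-last≢0 =
      apex-pairs-bound last c-last≢0 (λ (_ , last<2b) → <-irrefl last≡2b last<2b) (λ _ _ → cycle-close S small _ _)
      where
        open Pairs 0 b (subst (2 * b ≤_) (sym N≡1+2b) (n≤1+n _))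
        last≡2b : toℕ last ≡ 2 * b
        last≡2b = trans (toℕ-fromℕ (2 + k)) (suc-injective N≡1+2b)
    ... | yes c-last≡0 =
      apex-pairs-bound fzero (first-color-independent (Adj-sym (Cycle3+ k) wrap) c-last≡0) (λ { (() , _) })
        (λ _ _ → cycle-close S small _ _)
      where open Pairs 1 b (≤-reflexive (sym N≡1+2b))

  -- Cutting the cycle at the step x → y lays it out as a path from y (position 0) to x (position 2 + k).
  module Unrolling {x y : Fin (3 + k)} (x→y : CycStep k x y) where
    private
      cut = toℕ x
      e = 2 + k ∸ cut

      cut+e : cut + e ≡ 2 + k
      cut+e = m+[n∸m]≡n (toℕ≤pred[n] x)

    unroll : Fin (3 + k) → ℕ
    unroll v with toℕ v ≤? cut
    ... | yes _ = toℕ v + e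
    ... | no _  = toℕ v ∸ suc cut

    unroll-≤ : ∀ {v : Fin (3 + k)} → toℕ v ≤ cut → unroll v ≡ toℕ v + e
    unroll-≤ {v} v≤cut with toℕ v ≤? cut
    ... | yes _    = refl
    ... | no v≰cut = ⊥-elim (v≰cut v≤cut)

    unroll-> : ∀ {v : Fin (3 + k)} → cut < toℕ v → unroll v ≡ toℕ v ∸ suc cut
    unroll-> {v} cut<v with toℕ v ≤? cut
    ... | yes v≤cut = ⊥-elim (<⇒≱ cut<v v≤cut)
    ... | no _      = refl

    after-cut-< : ∀ {v : Fin (3 + k)} → cut < toℕ v → toℕ v ∸ suc cut < e
    after-cut-< {v} cut<v = subst (_≤ e) (m>n⇒m∸n≡suc[m∸suc[n]] cut<v) (∸-monoˡ-≤ cut (toℕ≤pred[n] v))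

    unroll-< : ∀ v → unroll v < 3 + k
    unroll-< v with toℕ v ≤? cut
    ... | yes v≤cut = s≤s (subst (toℕ v + e ≤_) cut+e (+-monoˡ-≤ e v≤cut))
    ... | no _      = ≤-<-trans (m∸n≤m (toℕ v) (suc cut)) (toℕ<n v)

    unroll-injective : Injective _≡_ _≡_ unroll
    unroll-injective {v} {v′} same with toℕ v ≤? cut | toℕ v′ ≤? cut
    ... | yes _    | yes _     = toℕ-injective (+-cancelʳ-≡ e _ _ same)
    ... | no v≰cut | no v′≰cut = toℕ-injective (begin
      toℕ v                       ≡⟨ sym (m∸n+n≡m (≰⇒> v≰cut)) ⟩
      toℕ v ∸ suc cut + suc cut   ≡⟨ cong (_+ suc cut) same ⟩
      toℕ v′ ∸ suc cut + suc cut  ≡⟨ m∸n+n≡m (≰⇒> v′≰cut) ⟩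
      toℕ v′                      ∎)
      where open ≡-Reasoning
    ... | yes _    | no v′≰cut =
      ⊥-elim (<-irrefl refl (<-≤-trans (subst (_< e) (sym same) (after-cut-< (≰⇒> v′≰cut))) (m≤n+m e _)))
    ... | no v≰cut | yes _     =
      ⊥-elim (<-irrefl refl (<-≤-trans (subst (_< e) same (after-cut-< (≰⇒> v≰cut))) (m≤n+m e _)))

    private
      off-cut-step : ∀ {w w′} → CycStep k w w′ → toℕ w ≢ cut → unroll w′ ≡ suc (unroll w)
      off-cut-step {w} {w′} (inj₁ w+1≡w′) w≢cut with <-cmp (toℕ w) cut
      ... | tri< w<cut _ _ = begin
        unroll w′         ≡⟨ unroll-≤ (subst (_≤ cut) w+1≡w′ w<cut) ⟩
        toℕ w′ + e        ≡⟨ cong (_+ e) (sym w+1≡w′) ⟩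
        suc (toℕ w + e)   ≡⟨ cong suc (sym (unroll-≤ (<⇒≤ w<cut))) ⟩
        suc (unroll w)    ∎
        where open ≡-Reasoning
      ... | tri≈ _ w≡cut _ = ⊥-elim (w≢cut w≡cut)
      ... | tri> _ _ cut<w = begin
        unroll w′                ≡⟨ unroll-> (subst (cut <_) w+1≡w′ (m≤n⇒m≤1+n cut<w)) ⟩
        toℕ w′ ∸ suc cut         ≡⟨ cong (_∸ suc cut) (sym w+1≡w′) ⟩
        toℕ w ∸ cut              ≡⟨ m>n⇒m∸n≡suc[m∸suc[n]] cut<w ⟩
        suc (toℕ w ∸ suc cut)    ≡⟨ cong suc (sym (unroll-> cut<w)) ⟩
        suc (unroll w)           ∎
        where open ≡-Reasoning
      off-cut-step {w} {w′} (inj₂ (w≡2+k , w′≡0)) w≢cut = begin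
        unroll w′                ≡⟨ unroll-≤ (subst (_≤ cut) (sym w′≡0) z≤n) ⟩
        toℕ w′ + e               ≡⟨ cong (_+ e) w′≡0 ⟩
        e                        ≡⟨ m>n⇒m∸n≡suc[m∸suc[n]] cut<2+k ⟩
        suc (2 + k ∸ suc cut)    ≡⟨ cong (suc ∘ (_∸ suc cut)) (sym w≡2+k) ⟩
        suc (toℕ w ∸ suc cut)    ≡⟨ cong suc (sym (unroll-> (subst (cut <_) (sym w≡2+k) cut<2+k))) ⟩
        suc (unroll w)           ∎
        where
          open ≡-Reasoning
          cut<2+k : cut < 2 + k
          cut<2+k = ≤∧≢⇒< (toℕ≤pred[n] x) (λ cut≡2+k → w≢cut (trans w≡2+k (sym cut≡2+k)))

    unroll-step : ∀ {w w′} → CycStep k w w′ → ¬ (w ≡ x × w′ ≡ y) → unroll w′ ≡ suc (unroll w)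
    unroll-step {w} w→w′ not-cut with toℕ w ≟ cut
    ... | no w≢cut  = off-cut-step w→w′ w≢cut
    ... | yes w≡cut = ⊥-elim (not-cut (w≡x , step-functional w→w′ (subst (λ z → CycStep k z y) (sym w≡x) x→y)))
      where
        w≡x : w ≡ x
        w≡x = toℕ-injective w≡cut

  missing-step : ∀ {H} (f : Subgraph H (Cycle3+ k)) → Proper f →
                 ∃₂ λ x y → CycStep k x y × (∀ {a b} → Adj H a b → ¬ (emb f a ≡ x × emb f b ≡ y))
  missing-step f (inj₁ (v , v∉f)) with cycle-successor v
  ... | w , v→w = v , w , v→w , λ {a} _ (a↦v , _) → v∉f a a↦v
  missing-step f (inj₂ (u , v , inj₁ u→v , no-uv)) = u , v , u→v , λ {a} {b} → no-uv a b
  missing-step {H} f (inj₂ (u , v , inj₂ v→u , no-uv)) =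
    v , u , v→u , λ {a} {b} ab (a↦v , b↦u) → no-uv b a (Adj-sym H ab) (b↦u , a↦v)

  proper-subgraph-colorable : ∀ {S K Q} → IsPathColoring S (3 + k) Q → (∀ {p} → p < 3 + k → Q p < K) →
                               ∀ H (f : Subgraph H (Cycle3+ k)) → Proper f → PackingColorable S H K
  proper-subgraph-colorable {S} {K} {Q} Q-ok Q<K H f proper with missing-step f proper
  ... | x , y , x→y , uncut = colorable-of-bounded S H (Q ∘ r) (λ a → Q<K (unroll-< (emb f a))) r-coloring
    where
      open Unrolling x→y

      r : Fin (size H) → ℕ
      r = unroll ∘ emb f

      r-adj : ∀ {a b} → Adj H a b → ∣ r a - r b ∣ ≤ 1
      r-adj {a} {b} ab with homEdge f ab
      ... | inj₁ a→b = ≤-reflexive (trans (cong (λ n → ∣ r a - n ∣) (unroll-step a→b (uncut ab))) (∣n-1+n∣≡1 (r a)))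
      ... | inj₂ b→a = ≤-reflexive (trans (∣-∣-comm (r a) (r b))
                         (trans (cong (λ n → ∣ r b - n ∣) (unroll-step b→a (uncut (Adj-sym H ab)))) (∣n-1+n∣≡1 (r b))))

      r-coloring : IsPackingColoringℕ S H (Q ∘ r)
      r-coloring a b a≢b same ℓ ℓ≤ walk =
        <-irrefl refl (<-≤-trans (Q-ok (unroll-< (emb f a)) (unroll-< (emb f b)) (a≢b ∘ inj f ∘ unroll-injective) same)
                                 (≤-trans (walk-lipschitz r r-adj walk) ℓ≤))

  even-step-parity : Even (3 + k) → ∀ {u v} → CycStep k u v → Even (toℕ u) → Even (toℕ v) → ⊥
  even-step-parity _      (inj₁ u+1≡v)       (a , u≡2a) ev-v =
    even-not-odd {toℕ _} ev-v (a , trans (sym u+1≡v) (cong suc u≡2a))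
  even-step-parity N-even (inj₂ (u≡2+k , _)) (a , u≡2a) _    =
    even-not-odd N-even (a , cong suc (trans (sym u≡2+k) u≡2a))

  even-cycle-bipartite : Even (3 + k) → ∀ {u v} → Adj (Cycle3+ k) u v → Even (toℕ u) → Even (toℕ v) → ⊥
  even-cycle-bipartite N-even (inj₁ u→v) ev-u ev-v = even-step-parity N-even u→v ev-u ev-v
  even-cycle-bipartite N-even (inj₂ v→u) ev-u ev-v = even-step-parity N-even v→u ev-v ev-u

Path3+ : ℕ → Graph
Path3+ k = record
  { size    = 3 + k
  ; Adj     = λ i j → suc (toℕ i) ≡ toℕ j ⊎ suc (toℕ j) ≡ toℕ i
  ; Adj-sym = λ { (inj₁ p) → inj₂ p ; (inj₂ p) → inj₁ p }
  ; irrefl  = λ { (inj₁ p) → 1+n≢n p ; (inj₂ p) → 1+n≢n p }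
  }

module Path (k : ℕ) where

  path-in-cycle : Subgraph (Path3+ k) (Cycle3+ k)
  path-in-cycle = record
    { emb     = λ v → v
    ; inj     = λ same → same
    ; homEdge = λ { (inj₁ p) → inj₁ (inj₁ p) ; (inj₂ p) → inj₂ (inj₁ p) }
    }

  path-in-cycle-proper : Proper path-in-cycle
  path-in-cycle-proper = inj₂ (Cycle.last k , fzero , Adj-sym (Cycle3+ k) (Cycle.wrap k) , no-wrap)
    where
      no-wrap : ∀ a b → Adj (Path3+ k) a b → ¬ (a ≡ Cycle.last k × b ≡ fzero)
      no-wrap a b (inj₁ a+1≡b) (_ , refl)    = 0≢1+n (sym a+1≡b)
      no-wrap a b (inj₂ 1≡a)   (refl , refl) = 0≢1+n (suc-injective (trans 1≡a (toℕ-fromℕ (2 + k))))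

  module LowerBound (S : PackingSeq) (s₁≡1 : seq S 0 ≡ 1) (short : suc k ≤ seq S 1)
                    {m : ℕ} (c : Fin (3 + k) → Fin (suc m)) (c-ok : IsPackingColoring S (Path3+ k) (suc m) c) where
    open Linear (Path3+ k) inj₁
    open PairChoice S s₁≡1 c c-ok

    -- Only the two end vertices can be further apart than s₂.
    even-path-bound : ∀ {b} → 3 + k ≡ 2 * b → suc b ≤ suc m
    even-path-bound {zero} ()
    even-path-bound {suc b} N≡2b+2 with c fzero ≟ᶠ fzero
    ... | yes c-0≡0 = pairs-bound (λ i j → window-close S 1 (off-0 i) (≤-end _) (off-0 j) (≤-end _))
      where
        open Pairs 0 (suc b) (≤-reflexive (sym N≡2b+2))
        off-0 : ∀ j → 1 ≤ toℕ (pairs j)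
        off-0 j = n≢0⇒n>0 (λ at-0 → pairs-nonfirst j (trans (cong c (toℕ-injective at-0)) c-0≡0))
        ≤-end : ∀ (v : Fin (3 + k)) → toℕ v ≤ 1 + seq S 1
        ≤-end v = ≤-trans (toℕ≤pred[n] v) (s≤s short)
    ... | no c-0≢0  = apex-pairs-bound fzero c-0≢0 (λ { (() , _) })
                        (λ i j → window-close S 0 z≤n (before-end i) z≤n (before-end j))
      where
        2+k≡1+2b : 2 + k ≡ suc (2 * b)
        2+k≡1+2b = suc-injective (trans N≡2b+2 (lo+2[1+i] 0 b))
        open Pairs 1 b (subst (_≤ 3 + k) 2+k≡1+2b (n≤1+n _))
        before-end : ∀ i → toℕ ((fzero ∷ pairs) i) ≤ seq S 1
        before-end fzero    = z≤n
        before-end (fsuc j) = ≤-trans (s≤s⁻¹ (subst (toℕ (pairs j) <_) (sym 2+k≡1+2b) (pairs-below j))) short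

-- Criticality

module _ (S : PackingSeq) (s₁≡1 : seq S 0 ≡ 1) (k : ℕ) where
  open Cycle k
  open Path k

  odd-cycle-critical : Odd (3 + k) → 3 + k ≤ 2 * seq S 1 + 1 → Critical S (Cycle3+ k)
  odd-cycle-critical (b , N≡1+2b) small =
    critical-of-bounds S (Cycle3+ k) (suc b)
      (lower-bound-of-nonempty {S} fzero λ c c-ok →
        LowerBounds.odd-cycle-bound S s₁≡1 (n≤m+1⇒n≤1+m small) c c-ok N≡1+2b)
      (proper-subgraph-colorable {S} (alternating-path-coloring S s₁≡1)
        (λ {p} p<N → alternating-< (subst (p <_) N≡1+2b p<N)))

  even-cycle-critical : Even (3 + k) → seq S 1 + 3 ≤ 3 + k → 3 + k ≤ 2 * seq S 1 + 1 →
                        Critical S (Cycle3+ k)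
  even-cycle-critical (b , N≡2b) long small =
    critical-of-bounds S (Cycle3+ k) b
      (lower-bound-of-nonempty {S} fzero λ c c-ok →
        LowerBounds.even-cycle-bound S s₁≡1 (n≤m+1⇒n≤1+m small) c c-ok N≡2b)
      (proper-subgraph-colorable {S} (recolor-last-coloring S s₁≡1 (subst (_≤ 3 + k) (+-comm (seq S 1) 3) long))
        (λ {p} p<N → subst (λ N → recolor-last N p < b) (sym N≡2b) (recolor-last-< 2≤b (subst (p <_) N≡2b p<N))))
    where
      2≤b : 2 ≤ b
      2≤b = *-cancelˡ-< 2 1 b (subst (2 <_) N≡2b (s≤s (s≤s (s≤s z≤n))))

  even-cycle-not-critical : Even (3 + k) → 3 + k ≤ seq S 1 + 2 → ¬ Critical S (Cycle3+ k)
  even-cycle-not-critical (b , N≡2b) short critical =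
    <-irrefl refl (critical (Path3+ k) path-in-cycle path-in-cycle-proper (s≤s z≤n) (suc b) (suc b) χ-cycle χ-path)
    where
      k+1≤s₂ : suc k ≤ seq S 1
      k+1≤s₂ = s≤s⁻¹ (s≤s⁻¹ (subst (3 + k ≤_) (+-comm (seq S 1) 2) short))
      small : 3 + k ≤ suc (2 * seq S 1)
      small = n≤m+1⇒n≤1+m (≤-trans short (s+2≤2s+1 (positive S 1)))
      alternating-ok : IsPackingColoringℕ S (Cycle3+ k) (alternating ∘ toℕ)
      alternating-ok = alternating-coloring S (Cycle3+ k) s₁≡1 (even-cycle-bipartite (b , N≡2b))
      alternating-<b+1 : ∀ (v : Fin (3 + k)) → alternating (toℕ v) < suc b
      alternating-<b+1 v = alternating-< (m≤n⇒m≤1+n (subst (toℕ v <_) N≡2b (toℕ<n v)))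
      χ-cycle : IsChiS S (Cycle3+ k) (suc b)
      χ-cycle = colorable-of-bounded S (Cycle3+ k) _ alternating-<b+1 alternating-ok ,
                lower-bound-of-nonempty {S} fzero λ c c-ok → LowerBounds.even-cycle-bound S s₁≡1 small c c-ok N≡2b
      χ-path : IsChiS S (Path3+ k) (suc b)
      χ-path = colorable-of-bounded S (Path3+ k) _ alternating-<b+1 (pullback {S} path-in-cycle alternating-ok) ,
               lower-bound-of-nonempty {S} fzero λ c c-ok → LowerBound.even-path-bound S s₁≡1 k+1≤s₂ c c-ok N≡2b

theorem4p2 : (S : PackingSeq) → seq S 0 ≡ 1 → (n : ℕ) → (h : 3 ≤ n) →
    (n ≤ seq S 1 + 2 → (Critical S (C n h) → n % 2 ≡ 1) × (n % 2 ≡ 1 → Critical S (C n h)))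
    × (seq S 1 + 3 ≤ n → n ≤ 2 * seq S 1 + 1 → Critical S (C n h))
theorem4p2 S s₁≡1 (suc (suc (suc k))) (s≤s (s≤s (s≤s z≤n))) = part-i , part-ii
  where
    part-i : 3 + k ≤ seq S 1 + 2 →
             (Critical S (Cycle3+ k) → (3 + k) % 2 ≡ 1) × ((3 + k) % 2 ≡ 1 → Critical S (Cycle3+ k))
    part-i short with even-or-odd (3 + k)
    ... | inj₁ even = (⊥-elim ∘ even-cycle-not-critical S s₁≡1 k even short) ,
                      (λ odd → ⊥-elim (0≢1+n (trans (sym (even-%2 even)) odd)))
    ... | inj₂ odd  = (λ _ → odd-%2 odd) ,
                      (λ _ → odd-cycle-critical S s₁≡1 k odd (≤-trans short (s+2≤2s+1 (positive S 1))))

    part-ii : seq S 1 + 3 ≤ 3 + k → 3 + k ≤ 2 * seq S 1 + 1 → Critical S (Cycle3+ k)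
    part-ii long small with even-or-odd (3 + k)
    ... | inj₁ even = even-cycle-critical S s₁≡1 k even long small
    ... | inj₂ odd  = odd-cycle-critical S s₁≡1 k odd small
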